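{- Let $\mathcal{N}$ be a $d$-dimensional strictly increasing affine net and $t\in\mathbb{N}^d$. Let $D_0=\mathbb{N}^d\setminus{\uparrow}\{t\}$ and $D_{k+1}=D_k\cap\mathrm{Pre}_\forall(D_k)$, and consider the resulting descending chain $D_0\supsetneq D_1\supsetneq\cdots$ (up to stabilisation). This chain is $\omega$-monotone.
   Context: A $d$-dimensional affine net is a finite set $\mathcal{N}$ of triples $(a,A,b)\in\mathbb{N}^d\times\mathbb{N}^{d\times d}\times\mathbb{N}^d$, with transitions $u\to A\cdot(u-a)+b$ for $u\in\mathbb{N}^d$, $(a,A,b)\in\mathcal{N}$ with $u-a\in\mathbb{N}^d$; it is strictly increasing if each such $A$ is componentwise $\ge$ the identity matrix, i.e. $A=\mathrm{Id}_d+A'$ with $A'\in\mathbb{N}^{d\times d}$. $\mathbb{N}^d$ is ordered componentwise by $\sqsubseteq$; ${\uparrow}$ is upward closure; $\mathrm{Pre}_\forall(S)=\{x:\forall y\,(x\to y\Rightarrow y\in S)\}$. Order ideals of $\mathbb{N}^d$ are identified with vectors $v\in(\mathbb{N}\cup\{\omega\})^d$ via $\{x:x\sqsubseteq v\}$; $\omega(I)=\{i: I(i)=\omega\}$. Each downwards-closed $D$ is uniquely a finite union of pairwise incomparable ideals (canonical decomposition); $I\in D$ means $I$ belongs to it; $I$ is proper at step $k$ if $I\in D_k$, $I\notin D_{k+1}$. The chain is $\omega$-monotone if whenever $I$ is proper at step $k+1$ there is $I'$ proper at step $k$ with $\omega(I)\subseteq\omega(I')$. -}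

module Defs where

open import Data.Nat using (ℕ; zero; suc; _+_; _*_; _∸_; _≤_)
open import Data.Fin using (Fin; zero; suc)
open import Data.List using (List)
open import Data.List.Membership.Propositional using (_∈_)
open import Data.Product using (Σ; ∃; _×_; _,_)
open import Relation.Binary.PropositionalEquality using (_≡_)
open import Relation.Nullary using (¬_)
open import Function.Bundles using (_⇔_)

Vecℕ : ℕ → Set
Vecℕ d = Fin d → ℕ

Matℕ : ℕ → Set
Matℕ d = Fin d → Fin d → ℕ

Σ[<_]_ : (n : ℕ) → (Fin n → ℕ) → ℕ
Σ[< zero ] f = 0
Σ[< suc n ] f = f zero + Σ[< n ] (λ i → f (suc i))

_⊑_ : {d : ℕ} → Vecℕ d → Vecℕ d → Set
u ⊑ v = ∀ i → u i ≤ v i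

_-v_ : {d : ℕ} → Vecℕ d → Vecℕ d → Vecℕ d
(u -v v) i = u i ∸ v i

_+v_ : {d : ℕ} → Vecℕ d → Vecℕ d → Vecℕ d
(u +v v) i = u i + v i

_·_ : {d : ℕ} → Matℕ d → Vecℕ d → Vecℕ d
_·_ {d} A v i = Σ[< d ] (λ j → A i j * v j)

δ : {d : ℕ} → Fin d → Fin d → ℕ
δ zero zero = 1
δ zero (suc j) = 0
δ (suc i) zero = 0
δ (suc i) (suc j) = δ i j

Triple : ℕ → Set
Triple d = Vecℕ d × Matℕ d × Vecℕ d

AffineNet : ℕ → Set
AffineNet d = List (Triple d)

StrictlyIncreasing : {d : ℕ} → AffineNet d → Set
StrictlyIncreasing {d} N =
  ∀ {a A b} → (a , A , b) ∈ N → ∀ (i j : Fin d) → δ i j ≤ A i j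

Step : {d : ℕ} → AffineNet d → Vecℕ d → Vecℕ d → Set
Step N u y = ∃ λ a → ∃ λ A → ∃ λ b →
  ((a , A , b) ∈ N) × (a ⊑ u) × (∀ i → y i ≡ ((A · (u -v a)) +v b) i)

SetV : ℕ → Set₁
SetV d = Vecℕ d → Set

PreAll : {d : ℕ} → AffineNet d → SetV d → SetV d
PreAll N S x = ∀ y → Step N x y → S y

Dchain : {d : ℕ} → AffineNet d → Vecℕ d → ℕ → SetV d
Dchain N t zero x = ¬ (t ⊑ x)
Dchain N t (suc k) x = Dchain N t k x × PreAll N (Dchain N t k) x

data ℕω : Set where
  fin : ℕ → ℕω
  ω   : ℕω

data _≤ω_ : ℕω → ℕω → Set where
  fin≤fin : ∀ {m n} → m ≤ n → fin m ≤ω fin n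
  _≤ω-ω   : ∀ x → x ≤ω ω

-- Order ideals of ℕ^d, identified with vectors in (ℕ ∪ {ω})^d.
Ideal : ℕ → Set
Ideal d = Fin d → ℕω

_⊑I_ : {d : ℕ} → Vecℕ d → Ideal d → Set
x ⊑I I = ∀ i → fin (x i) ≤ω I i

_≤I_ : {d : ℕ} → Ideal d → Ideal d → Set
I ≤I J = ∀ i → I i ≤ω J i

IsCanonicalDecomp : {d : ℕ} → SetV d → List (Ideal d) → Set
IsCanonicalDecomp {d} D L =
  (∀ (x : Vecℕ d) → D x ⇔ (∃ λ I → (I ∈ L) × (x ⊑I I)))
  × (∀ {I J} → I ∈ L → J ∈ L → I ≤I J → J ≤I I)

_∈dec_ : {d : ℕ} → Ideal d → SetV d → Set
_∈dec_ {d} I D = ∃ λ (L : List (Ideal d)) → IsCanonicalDecomp D L × (I ∈ L)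

ProperAt : {d : ℕ} → AffineNet d → Vecℕ d → ℕ → Ideal d → Set
ProperAt N t k I = (I ∈dec Dchain N t k) × ¬ (I ∈dec Dchain N t (suc k))

ωsub : {d : ℕ} → Ideal d → Ideal d → Set
ωsub I J = ∀ i → I i ≡ ω → J i ≡ ω

OmegaMonotone : {d : ℕ} → AffineNet d → Vecℕ d → Set
OmegaMonotone {d} N t = ∀ (k : ℕ) (I : Ideal d) → ProperAt N t (suc k) I →
  ∃ λ (I' : Ideal d) → ProperAt N t k I' × ωsub I I'

-- Each D_k is the complement of the upward closure of a finite basis: {t}, extended at each step
-- by the minimal predecessors of the previous basis, which lie in a finite box. So every D_k has a
-- canonical decomposition. Let I be proper at step k+1 and let x be I with its ω-coordinates set to
-- a number n exceeding all finite entries of the decompositions of D_k and D_{k+2} plus all source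
-- vectors a of the net. Then x ∈ D_{k+1}, but x ∉ D_{k+2}, for otherwise I would lie below an ideal
-- of D_{k+2} and so belong to its decomposition. Hence some step x → y leaves D_{k+1}, while y ∈ D_k.
-- As the net is strictly increasing, y is still above the finite entries of D_k on the ω-coordinates
-- of I, so the ideal of D_k containing y is ω there, and it is not an ideal of D_{k+1}.
module Submission where

open import Data.Nat using (ℕ; zero; suc; _+_; _*_; _≤_; _<_; _⊓_; z≤n; s≤s)
open import Data.Nat.Properties hiding (_≟_)
open import Data.Fin using (Fin; zero; suc; _≟_)
open import Data.Fin.Properties using (all?; ¬∀⟶∃¬)
open import Data.List
  using (List; []; _∷_; [_]; _++_; foldr; map; filter; upTo; allFin; concatMap; cartesianProduct; cartesianProductWith)
open import Data.List.Relation.Unary.Any using (here; there; any?)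
open import Data.List.Membership.Propositional using (_∈_; find; lose)
open import Data.List.Membership.Propositional.Properties
  using ( ∈-++⁺ˡ; ∈-++⁺ʳ; ∈-++⁻; ∈-filter⁺; ∈-filter⁻; ∈-map∘filter⁺; ∈-map∘filter⁻; ∈-concatMap⁺; ∈-concatMap⁻
        ; ∈-cartesianProductWith⁺; ∈-cartesianProductWith⁻; ∈-cartesianProduct⁺; ∈-cartesianProduct⁻; ∈-allFin; ∈-upTo⁺)
open import Data.Product using (∃; _×_; _,_; proj₁; proj₂; uncurry)
open import Data.Sum using (_⊎_; inj₁; inj₂)
open import Data.Empty using (⊥-elim)
import Data.Vec.Functional as V
open import Relation.Nullary using (Dec; yes; no; ¬_; ¬?)
open import Relation.Nullary.Decidable using (map′)
open import Relation.Binary.PropositionalEquality using (_≡_; refl; sym; cong; subst)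
open import Function.Bundles using (_⇔_; mk⇔; Equivalence)

open import Defs

Σ-≤ : ∀ {n} (f : Fin n → ℕ) i → f i ≤ Σ[< n ] f
Σ-≤ f zero = m≤m+n _ _
Σ-≤ {suc n} f (suc i) = ≤-trans (Σ-≤ (λ j → f (suc j)) i) (m≤n+m _ (f zero))

Σ-mono-≤ : ∀ {n} {f g : Fin n → ℕ} → (∀ i → f i ≤ g i) → Σ[< n ] f ≤ Σ[< n ] g
Σ-mono-≤ {zero} f≤g = z≤n
Σ-mono-≤ {suc n} f≤g = +-mono-≤ (f≤g zero) (Σ-mono-≤ (λ j → f≤g (suc j)))

+-⊓-subadditive : ∀ m n o → (m + n) ⊓ o ≤ m ⊓ o + n ⊓ o
+-⊓-subadditive m n o with ≤-total m o | ≤-total n o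
... | inj₁ m≤o | inj₁ n≤o rewrite m≤n⇒m⊓n≡m m≤o | m≤n⇒m⊓n≡m n≤o = m⊓n≤m (m + n) o
... | _ | inj₂ o≤n rewrite m≥n⇒m⊓n≡n o≤n = ≤-trans (m⊓n≤n (m + n) o) (m≤n+m o (m ⊓ o))
... | inj₂ o≤m | _ rewrite m≥n⇒m⊓n≡n o≤m = ≤-trans (m⊓n≤n (m + n) o) (m≤m+n o (n ⊓ o))

*-⊓-≤ : ∀ m n o → (m * n) ⊓ o ≤ m * (n ⊓ o)
*-⊓-≤ zero n o = z≤n
*-⊓-≤ m@(suc _) n o rewrite *-distribˡ-⊓ m n o = ⊓-monoʳ-≤ (m * n) (m≤n*m o m)

Σ-*-⊓-≤ : ∀ {n} (f w : Fin n → ℕ) o →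
          (Σ[< n ] λ j → f j * w j) ⊓ o ≤ Σ[< n ] λ j → f j * (w j ⊓ o)
Σ-*-⊓-≤ {zero} f w o = z≤n
Σ-*-⊓-≤ {suc n} f w o = ≤-trans (+-⊓-subadditive (f zero * w zero) _ o)
  (+-mono-≤ (*-⊓-≤ (f zero) (w zero) o) (Σ-*-⊓-≤ (λ j → f (suc j)) (λ j → w (suc j)) o))

·-mono-⊑ : ∀ {d} (A : Matℕ d) {w w′ : Vecℕ d} → w ⊑ w′ → (A · w) ⊑ (A · w′)
·-mono-⊑ A w⊑w′ i = Σ-mono-≤ (λ j → *-monoʳ-≤ (A i j) (w⊑w′ j))

·-inflationary : ∀ {d} (A : Matℕ d) (w : Vecℕ d) i → 1 ≤ A i i → w i ≤ (A · w) i
·-inflationary A w i 1≤Aii = begin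
  w i          ≡⟨ sym (*-identityˡ (w i)) ⟩
  1 * w i      ≤⟨ *-monoˡ-≤ (w i) 1≤Aii ⟩
  A i i * w i  ≤⟨ Σ-≤ (λ j → A i j * w j) i ⟩
  (A · w) i    ∎
  where open ≤-Reasoning

·-truncate : ∀ {d} (A : Matℕ d) (w b v : Vecℕ d) M → (∀ i → v i ≤ M) →
             v ⊑ ((A · w) +v b) → v ⊑ ((A · (λ j → w j ⊓ M)) +v b)
·-truncate A w b v M v≤M v⊑ i = begin
  v i                                   ≤⟨ ⊓-glb (v⊑ i) (v≤M i) ⟩
  ((A · w) i + b i) ⊓ M                 ≤⟨ +-⊓-subadditive ((A · w) i) (b i) M ⟩
  (A · w) i ⊓ M + b i ⊓ M               ≤⟨ +-mono-≤ (Σ-*-⊓-≤ (A i) w M) (m⊓n≤m (b i) M) ⟩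
  (A · (λ j → w j ⊓ M)) i + b i         ∎
  where open ≤-Reasoning

≤ω-trans : ∀ {p q r} → p ≤ω q → q ≤ω r → p ≤ω r
≤ω-trans (fin≤fin p≤q) (fin≤fin q≤r) = fin≤fin (≤-trans p≤q q≤r)
≤ω-trans {p} _ (_ ≤ω-ω) = p ≤ω-ω

_≤ω?_ : (p q : ℕω) → Dec (p ≤ω q)
fin m ≤ω? fin n = map′ fin≤fin (λ { (fin≤fin m≤n) → m≤n }) (m ≤? n)
p ≤ω? ω = yes (p ≤ω-ω)
ω ≤ω? fin n = no λ ()

infixl 30 _⊓ω_

_⊓ω_ : ℕω → ℕω → ℕω
fin m ⊓ω fin n = fin (m ⊓ n)
fin m ⊓ω ω = fin m
ω ⊓ω q = q

≤ω-⊓ω⁻ : ∀ {n} p q → fin n ≤ω p ⊓ω q → fin n ≤ω p × fin n ≤ω q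
≤ω-⊓ω⁻ (fin m) (fin m′) (fin≤fin le) = fin≤fin (≤-trans le (m⊓n≤m m m′)) , fin≤fin (≤-trans le (m⊓n≤n m m′))
≤ω-⊓ω⁻ (fin m) ω le = le , _ ≤ω-ω
≤ω-⊓ω⁻ ω q le = _ ≤ω-ω , le

≤ω-⊓ω⁺ : ∀ {n} p q → fin n ≤ω p → fin n ≤ω q → fin n ≤ω p ⊓ω q
≤ω-⊓ω⁺ (fin m) (fin m′) (fin≤fin le) (fin≤fin le′) = fin≤fin (⊓-glb le le′)
≤ω-⊓ω⁺ (fin m) ω le _ = le
≤ω-⊓ω⁺ ω q _ le = le

module _ {d : ℕ} where

  ≤I-trans : {I J K : Ideal d} → I ≤I J → J ≤I K → I ≤I K
  ≤I-trans I≤J J≤K i = ≤ω-trans (I≤J i) (J≤K i)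

  ⊑I-≤I-trans : {x : Vecℕ d} {I J : Ideal d} → x ⊑I I → I ≤I J → x ⊑I J
  ⊑I-≤I-trans x⊑I I≤J i = ≤ω-trans (x⊑I i) (I≤J i)

  _≤I?_ : (I J : Ideal d) → Dec (I ≤I J)
  I ≤I? J = all? (λ i → I i ≤ω? J i)

  _⊑?_ : (u x : Vecℕ d) → Dec (u ⊑ x)
  u ⊑? x = all? (λ i → u i ≤? x i)

  _∈⋃_ : Vecℕ d → List (Ideal d) → Set
  x ∈⋃ L = ∃ λ I → I ∈ L × x ⊑I I

  Antichain : List (Ideal d) → Set
  Antichain L = ∀ {I J} → I ∈ L → J ∈ L → I ≤I J → J ≤I I

  _∈↑_ : Vecℕ d → List (Vecℕ d) → Set
  x ∈↑ B = ∃ λ u → u ∈ B × u ⊑ x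

  _∈↑?_ : ∀ x B → Dec (x ∈↑ B)
  x ∈↑? B = map′ find (λ (_ , u∈B , u⊑x) → lose u∈B u⊑x) (any? (_⊑? x) B)

  dropBelow : Ideal d → List (Ideal d) → List (Ideal d)
  dropBelow I = filter (λ J → ¬? (J ≤I? I))

  ∈-dropBelow⁻ : ∀ {I J} L → J ∈ dropBelow I L → J ∈ L × ¬ J ≤I I
  ∈-dropBelow⁻ L = ∈-filter⁻ _ {xs = L}

  insert : Ideal d → List (Ideal d) → List (Ideal d)
  insert I L with any? (I ≤I?_) L
  ... | yes _ = L
  ... | no _ = I ∷ dropBelow I L

  insert-antichain : ∀ I L → Antichain L → Antichain (insert I L)
  insert-antichain I L anti with any? (I ≤I?_) L
  ... | yes _ = anti
  ... | no I≰L = anti′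
    where
    anti′ : Antichain (I ∷ dropBelow I L)
    anti′ (here refl) (here refl) I≤I = I≤I
    anti′ (here refl) (there J∈) I≤J = ⊥-elim (I≰L (lose (proj₁ (∈-dropBelow⁻ L J∈)) I≤J))
    anti′ (there J∈) (here refl) J≤I = ⊥-elim (proj₂ (∈-dropBelow⁻ L J∈) J≤I)
    anti′ (there J∈) (there K∈) J≤K = anti (proj₁ (∈-dropBelow⁻ L J∈)) (proj₁ (∈-dropBelow⁻ L K∈)) J≤K

  ∈⋃-insert⁻ : ∀ I L {x} → x ∈⋃ insert I L → x ⊑I I ⊎ x ∈⋃ L
  ∈⋃-insert⁻ I L x∈ with any? (I ≤I?_) L
  ... | yes _ = inj₂ x∈
  ∈⋃-insert⁻ I L (_ , here refl , x⊑I) | no _ = inj₁ x⊑I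
  ∈⋃-insert⁻ I L (J , there J∈ , x⊑J) | no _ = inj₂ (J , proj₁ (∈-dropBelow⁻ L J∈) , x⊑J)

  ∈⋃-insert⁺ : ∀ I L {x} → x ⊑I I ⊎ x ∈⋃ L → x ∈⋃ insert I L
  ∈⋃-insert⁺ I L x∈ with any? (I ≤I?_) L
  ∈⋃-insert⁺ I L (inj₁ x⊑I) | yes I≤L = let (J , J∈ , I≤J) = find I≤L in J , J∈ , ⊑I-≤I-trans x⊑I I≤J
  ∈⋃-insert⁺ I L (inj₂ x∈L) | yes _ = x∈L
  ∈⋃-insert⁺ I L (inj₁ x⊑I) | no _ = I , here refl , x⊑I
  ∈⋃-insert⁺ I L (inj₂ (J , J∈ , x⊑J)) | no _ with J ≤I? I
  ... | yes J≤I = I , here refl , ⊑I-≤I-trans x⊑J J≤I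
  ... | no J≰I = J , there (∈-filter⁺ _ J∈ J≰I) , x⊑J

  reduce : List (Ideal d) → List (Ideal d)
  reduce = foldr insert []

  reduce-antichain : ∀ L → Antichain (reduce L)
  reduce-antichain [] ()
  reduce-antichain (I ∷ L) = insert-antichain I (reduce L) (reduce-antichain L)

  ∈⋃-reduce⁻ : ∀ L {x} → x ∈⋃ reduce L → x ∈⋃ L
  ∈⋃-reduce⁻ (I ∷ L) x∈ with ∈⋃-insert⁻ I (reduce L) x∈
  ... | inj₁ x⊑I = I , here refl , x⊑I
  ... | inj₂ x∈L = let (J , J∈ , x⊑J) = ∈⋃-reduce⁻ L x∈L in J , there J∈ , x⊑J

  ∈⋃-reduce⁺ : ∀ L {x} → x ∈⋃ L → x ∈⋃ reduce L
  ∈⋃-reduce⁺ (I ∷ L) (_ , here refl , x⊑I) = ∈⋃-insert⁺ I (reduce L) (inj₁ x⊑I)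
  ∈⋃-reduce⁺ (I ∷ L) (J , there J∈ , x⊑J) = ∈⋃-insert⁺ I (reduce L) (inj₂ (∈⋃-reduce⁺ L (J , J∈ , x⊑J)))

  reduce-canonical : ∀ {D : SetV d} L → (∀ x → D x ⇔ x ∈⋃ L) → IsCanonicalDecomp D (reduce L)
  reduce-canonical L D⇔L = (λ x → mk⇔ (λ Dx → ∈⋃-reduce⁺ L (Equivalence.to (D⇔L x) Dx))
                                      (λ x∈ → Equivalence.from (D⇔L x) (∈⋃-reduce⁻ L x∈)))
                         , reduce-antichain L

  belowAt : Fin d → ℕ → Ideal d
  belowAt i m j with i ≟ j
  ... | yes _ = fin m
  ... | no _ = ω

  ⊑I-belowAt⁺ : ∀ i m {x} → x i ≤ m → x ⊑I belowAt i m
  ⊑I-belowAt⁺ i m xi≤m j with i ≟ j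
  ... | yes refl = fin≤fin xi≤m
  ... | no _ = _ ≤ω-ω

  ⊑I-belowAt⁻ : ∀ i m {x} → x ⊑I belowAt i m → x i ≤ m
  ⊑I-belowAt⁻ i m x⊑ with i ≟ i | x⊑ i
  ... | yes refl | fin≤fin xi≤m = xi≤m
  ... | no i≢i | _ = ⊥-elim (i≢i refl)

  strictlyBelowAt : Fin d → ℕ → List (Ideal d)
  strictlyBelowAt i zero = []
  strictlyBelowAt i (suc m) = [ belowAt i m ]

  ∈⋃-strictlyBelowAt⁻ : ∀ i n {x} → x ∈⋃ strictlyBelowAt i n → x i < n
  ∈⋃-strictlyBelowAt⁻ i (suc m) (_ , here refl , x⊑) = s≤s (⊑I-belowAt⁻ i m x⊑)

  ∈⋃-strictlyBelowAt⁺ : ∀ i n {x} → x i < n → x ∈⋃ strictlyBelowAt i n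
  ∈⋃-strictlyBelowAt⁺ i (suc m) (s≤s xi≤m) = belowAt i m , here refl , ⊑I-belowAt⁺ i m xi≤m

  coneComplement : Vecℕ d → List (Ideal d)
  coneComplement u = concatMap (λ i → strictlyBelowAt i (u i)) (allFin d)

  ∈⋃-coneComplement⁻ : ∀ u {x} → x ∈⋃ coneComplement u → ¬ u ⊑ x
  ∈⋃-coneComplement⁻ u (I , I∈ , x⊑I) u⊑x =
    let (i , _ , I∈i) = find (∈-concatMap⁻ (λ i → strictlyBelowAt i (u i)) {xs = allFin d} I∈)
    in <⇒≱ (∈⋃-strictlyBelowAt⁻ i (u i) (I , I∈i , x⊑I)) (u⊑x i)

  ∈⋃-coneComplement⁺ : ∀ u {x} → ¬ u ⊑ x → x ∈⋃ coneComplement u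
  ∈⋃-coneComplement⁺ u {x} u⋢x =
    let (i , ui≰xi) = ¬∀⟶∃¬ d (λ i → u i ≤ x i) (λ i → u i ≤? x i) u⋢x
        (I , I∈i , x⊑I) = ∈⋃-strictlyBelowAt⁺ i (u i) (≰⇒> ui≰xi)
    in I , ∈-concatMap⁺ (λ i → strictlyBelowAt i (u i)) (lose (∈-allFin i) I∈i) , x⊑I

  infixl 30 _⊓I_

  _⊓I_ : Ideal d → Ideal d → Ideal d
  (I ⊓I J) i = I i ⊓ω J i

  meets : List (Ideal d) → List (Ideal d) → List (Ideal d)
  meets = cartesianProductWith _⊓I_

  ∈⋃-meets⁻ : ∀ L L′ {x} → x ∈⋃ meets L L′ → x ∈⋃ L × x ∈⋃ L′
  ∈⋃-meets⁻ L L′ (K , K∈ , x⊑K) with ∈-cartesianProductWith⁻ _⊓I_ L L′ K∈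
  ... | I , J , I∈ , J∈ , refl = (I , I∈ , λ i → proj₁ (≤ω-⊓ω⁻ (I i) (J i) (x⊑K i)))
                               , (J , J∈ , λ i → proj₂ (≤ω-⊓ω⁻ (I i) (J i) (x⊑K i)))

  ∈⋃-meets⁺ : ∀ L L′ {x} → x ∈⋃ L → x ∈⋃ L′ → x ∈⋃ meets L L′
  ∈⋃-meets⁺ L L′ (I , I∈ , x⊑I) (J , J∈ , x⊑J) =
    I ⊓I J , ∈-cartesianProductWith⁺ _⊓I_ I∈ J∈ , λ i → ≤ω-⊓ω⁺ (I i) (J i) (x⊑I i) (x⊑J i)

  upsetComplement : List (Vecℕ d) → List (Ideal d)
  upsetComplement = foldr (λ u → meets (coneComplement u)) [ (λ _ → ω) ]

  ∈⋃-upsetComplement⁻ : ∀ B {x} → x ∈⋃ upsetComplement B → ¬ x ∈↑ B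
  ∈⋃-upsetComplement⁻ (u ∷ B) x∈ (_ , here refl , u⊑x) =
    ∈⋃-coneComplement⁻ u (proj₁ (∈⋃-meets⁻ (coneComplement u) (upsetComplement B) x∈)) u⊑x
  ∈⋃-upsetComplement⁻ (u ∷ B) x∈ (v , there v∈ , v⊑x) =
    ∈⋃-upsetComplement⁻ B (proj₂ (∈⋃-meets⁻ (coneComplement u) (upsetComplement B) x∈)) (v , v∈ , v⊑x)

  ∈⋃-upsetComplement⁺ : ∀ B {x} → ¬ x ∈↑ B → x ∈⋃ upsetComplement B
  ∈⋃-upsetComplement⁺ [] _ = _ , here refl , λ _ → _ ≤ω-ω
  ∈⋃-upsetComplement⁺ (u ∷ B) x∉ = ∈⋃-meets⁺ (coneComplement u) (upsetComplement B)
    (∈⋃-coneComplement⁺ u (λ u⊑x → x∉ (u , here refl , u⊑x)))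
    (∈⋃-upsetComplement⁺ B (λ (v , v∈ , v⊑x) → x∉ (v , there v∈ , v⊑x)))

  upsetComplement-canonical : ∀ {D : SetV d} B → (∀ x → D x ⇔ (¬ x ∈↑ B)) →
                              IsCanonicalDecomp D (reduce (upsetComplement B))
  upsetComplement-canonical B D⇔ = reduce-canonical (upsetComplement B) λ x →
    mk⇔ (λ Dx → ∈⋃-upsetComplement⁺ B (Equivalence.to (D⇔ x) Dx))
        (λ x∈ → Equivalence.from (D⇔ x) (∈⋃-upsetComplement⁻ B x∈))

finPart : ℕω → ℕ
finPart (fin m) = m
finPart ω = 0

finOr : ℕ → ℕω → ℕ
finOr n (fin m) = m
finOr n ω = n

≤ω-finPart⇒ω : ∀ {n q} → fin n ≤ω q → finPart q < n → q ≡ ω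
≤ω-finPart⇒ω (fin≤fin n≤m) m<n = ⊥-elim (<⇒≱ m<n n≤m)
≤ω-finPart⇒ω (_ ≤ω-ω) _ = refl

finOr-≤ω : ∀ n p → fin (finOr n p) ≤ω p
finOr-≤ω n (fin m) = fin≤fin ≤-refl
finOr-≤ω n ω = _ ≤ω-ω

finOr-≤ω-reflect : ∀ {n} p q → (fin n ≤ω q → q ≡ ω) → fin (finOr n p) ≤ω q → p ≤ω q
finOr-≤ω-reflect (fin m) q _ m≤q = m≤q
finOr-≤ω-reflect ω q large⇒ω n≤q = subst (ω ≤ω_) (sym (large⇒ω n≤q)) (ω ≤ω-ω)

module _ {d : ℕ} where

  bound : List (Ideal d) → ℕ
  bound [] = 0
  bound (I ∷ L) = Σ[< d ] (λ i → finPart (I i)) + bound L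

  finPart-≤-bound : ∀ {I L} → I ∈ L → ∀ i → finPart (I i) ≤ bound L
  finPart-≤-bound {I} (here refl) i = ≤-trans (Σ-≤ (λ j → finPart (I j)) i) (m≤m+n _ _)
  finPart-≤-bound {L = J ∷ L} (there I∈) i = ≤-trans (finPart-≤-bound I∈ i) (m≤n+m _ _)

  beyond-bound⇒ω : ∀ {I L n} → I ∈ L → bound L < n → ∀ i → fin n ≤ω I i → I i ≡ ω
  beyond-bound⇒ω I∈ lt i n≤Ii = ≤ω-finPart⇒ω n≤Ii (≤-<-trans (finPart-≤-bound I∈ i) lt)

  fillω : Ideal d → ℕ → Vecℕ d
  fillω I n i = finOr n (I i)

  fillω-⊑I : ∀ I n → fillω I n ⊑I I
  fillω-⊑I I n i = finOr-≤ω n (I i)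

  fillω-ω : ∀ I n {i} → I i ≡ ω → fillω I n i ≡ n
  fillω-ω I n Ii≡ω = cong (finOr n) Ii≡ω

  fillω-≤I : ∀ {I J n} → (∀ i → fin n ≤ω J i → J i ≡ ω) → fillω I n ⊑I J → I ≤I J
  fillω-≤I {I} {J} large⇒ω x⊑J i = finOr-≤ω-reflect (I i) (J i) (large⇒ω i) (x⊑J i)

  ∈dec-⊆ : ∀ {D : SetV d} {I x} → I ∈dec D → x ⊑I I → D x
  ∈dec-⊆ (_ , (D⇔L , _) , I∈L) x⊑I = Equivalence.from (D⇔L _) (_ , I∈L , x⊑I)

  -- `fillω J (suc (bound L))` lies in J, and can only lie in members of L lying above J.
  ideal⊆⇒≤member : ∀ {D : SetV d} {L J} → IsCanonicalDecomp D L → (∀ {x} → x ⊑I J → D x) →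
                   ∃ λ J′ → J′ ∈ L × J ≤I J′
  ideal⊆⇒≤member {L = L} {J} (D⇔L , _) J⊆D =
    let (J′ , J′∈ , x⊑J′) = Equivalence.to (D⇔L _) (J⊆D (fillω-⊑I J (suc (bound L))))
    in J′ , J′∈ , fillω-≤I (beyond-bound⇒ω J′∈ ≤-refl) x⊑J′

  -- Ideals are functions, so I ≤I J ≤I I does not make I ≡ J; instead I is added next to J.
  ∷-canonical : ∀ {D : SetV d} {L I J} → IsCanonicalDecomp D L → J ∈ L → I ≤I J → J ≤I I →
                IsCanonicalDecomp D (I ∷ L)
  ∷-canonical {D = D} {L = L} {I = I} {J = J} (D⇔L , anti) J∈ I≤J J≤I = (λ x → mk⇔ (to x) (from x)) , anti′
    where
    to : ∀ x → D x → x ∈⋃ (I ∷ L)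
    to x Dx = let (K , K∈ , x⊑K) = Equivalence.to (D⇔L x) Dx in K , there K∈ , x⊑K
    from : ∀ x → x ∈⋃ (I ∷ L) → D x
    from x (_ , here refl , x⊑I) = Equivalence.from (D⇔L x) (J , J∈ , ⊑I-≤I-trans x⊑I I≤J)
    from x (K , there K∈ , x⊑K) = Equivalence.from (D⇔L x) (K , K∈ , x⊑K)
    anti′ : Antichain (I ∷ L)
    anti′ (here refl) (here refl) I≤I = I≤I
    anti′ (here refl) (there K∈) I≤K = ≤I-trans (anti J∈ K∈ (≤I-trans J≤I I≤K)) J≤I
    anti′ (there K∈) (here refl) K≤I = ≤I-trans I≤J (anti K∈ J∈ (≤I-trans K≤I I≤J))
    anti′ (there K∈) (there K′∈) K≤K′ = anti K∈ K′∈ K≤K′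

  ∈dec-shrink : ∀ {D D′ : SetV d} {L L′ I J} → IsCanonicalDecomp D′ L′ → I ∈ L′ →
                IsCanonicalDecomp D L → (∀ {x} → D x → D′ x) → J ∈ L → I ≤I J → I ∈dec D
  ∈dec-shrink {L = L} {I = I} decD′ I∈ decD D⊆D′ J∈ I≤J =
    let (J′ , J′∈ , J≤J′) = ideal⊆⇒≤member decD′ (λ x⊑J → D⊆D′ (∈dec-⊆ (L , decD , J∈) x⊑J))
        J≤I = ≤I-trans J≤J′ (proj₂ decD′ I∈ J′∈ (≤I-trans I≤J J≤J′))
    in I ∷ L , ∷-canonical decD J∈ I≤J J≤I , here refl

  fillω-escapes : ∀ {D D′ : SetV d} {L L′ I n} → IsCanonicalDecomp D′ L′ → I ∈ L′ → ¬ I ∈dec D →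
                  IsCanonicalDecomp D L → (∀ {x} → D x → D′ x) → bound L < n → ¬ D (fillω I n)
  fillω-escapes decD′ I∈ I∉ decD D⊆D′ lt Dx =
    let (J , J∈ , x⊑J) = Equivalence.to (proj₁ decD _) Dx
    in I∉ (∈dec-shrink decD′ I∈ decD D⊆D′ J∈ (fillω-≤I (beyond-bound⇒ω J∈ lt) x⊑J))

box : (d M : ℕ) → List (Vecℕ d)
box zero M = [ V.[] ]
box (suc d) M = cartesianProductWith V._∷_ (upTo (suc M)) (box d M)

box-complete : ∀ d M (z : Vecℕ d) → (∀ i → z i ≤ M) → ∃ λ w → w ∈ box d M × (∀ i → w i ≡ z i)
box-complete zero M z _ = V.[] , here refl , λ ()
box-complete (suc d) M z z≤M =
  let (w , w∈ , w≡z) = box-complete d M (V.tail z) (λ i → z≤M (suc i))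
  in z zero V.∷ w , ∈-cartesianProductWith⁺ V._∷_ (∈-upTo⁺ (s≤s (z≤M zero))) w∈
   , λ { zero → refl ; (suc i) → w≡z i }

module _ {d : ℕ} where

  -- By ·-truncate, the minimal x with a ⊑ x and v ⊑ A (x - a) + b are among the w + a whose
  -- entries are at most Σ v.
  minimalPredecessors : Vecℕ d → Triple d → List (Vecℕ d)
  minimalPredecessors v (a , A , b) =
    map (_+v a) (filter (λ w → v ⊑? ((A · w) +v b)) (box d (Σ[< d ] v)))

  minimalPredecessors-sound : ∀ {v a A b u x} → u ∈ minimalPredecessors v (a , A , b) → u ⊑ x →
                              a ⊑ x × v ⊑ ((A · (x -v a)) +v b)
  minimalPredecessors-sound {v} {a} {A} {b} {x = x} u∈ u⊑x =
    let (w , _ , u≡w+a , v⊑Aw+b) =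
          ∈-map∘filter⁻ (_+v a) (λ w → v ⊑? ((A · w) +v b)) {xs = box d (Σ[< d ] v)} u∈
        w+a⊑x = subst (_⊑ x) u≡w+a u⊑x
        w⊑x-a : w ⊑ (x -v a)
        w⊑x-a i = m+n≤o⇒m≤o∸n (w i) (w+a⊑x i)
    in (λ i → m+n≤o⇒n≤o (w i) (w+a⊑x i))
     , λ i → ≤-trans (v⊑Aw+b i) (+-monoˡ-≤ (b i) (·-mono-⊑ A w⊑x-a i))

  minimalPredecessors-complete : ∀ {v a A b x} → a ⊑ x → v ⊑ ((A · (x -v a)) +v b) →
                                 ∃ λ u → u ∈ minimalPredecessors v (a , A , b) × u ⊑ x
  minimalPredecessors-complete {v} {a} {A} {b} {x} a⊑x v⊑y =
    let M = Σ[< d ] v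
        (w , w∈ , w≡z) = box-complete d M (λ j → (x -v a) j ⊓ M) (λ j → m⊓n≤n _ M)
        v⊑Aw+b : v ⊑ ((A · w) +v b)
        v⊑Aw+b i = ≤-trans (·-truncate A (x -v a) b v M (Σ-≤ v) v⊑y i)
                           (+-monoˡ-≤ (b i) (·-mono-⊑ A (λ j → ≤-reflexive (sym (w≡z j))) i))
        w⊑x-a : w ⊑ (x -v a)
        w⊑x-a j = ≤-trans (≤-reflexive (w≡z j)) (m⊓n≤m _ M)
    in w +v a , ∈-map∘filter⁺ (_+v a) (λ w → v ⊑? ((A · w) +v b)) {xs = box d M} (w , w∈ , refl , v⊑Aw+b)
     , λ i → m≤o∸n⇒m+n≤o (w i) (a⊑x i) (w⊑x-a i)

  predecessorBasis : AffineNet d → List (Vecℕ d) → List (Vecℕ d)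
  predecessorBasis N B = concatMap (uncurry minimalPredecessors) (cartesianProduct B N)

  predecessorBasis-sound : ∀ N B {x} → x ∈↑ predecessorBasis N B → ∃ λ y → Step N x y × y ∈↑ B
  predecessorBasis-sound N B (u , u∈ , u⊑x) =
    let ((v , (a , A , b)) , vτ∈ , u∈′) =
          find (∈-concatMap⁻ (uncurry minimalPredecessors) {xs = cartesianProduct B N} u∈)
        (v∈ , τ∈) = ∈-cartesianProduct⁻ B N vτ∈
        (a⊑x , v⊑y) = minimalPredecessors-sound {v} {a} {A} {b} u∈′ u⊑x
    in _ , (a , A , b , τ∈ , a⊑x , λ _ → refl) , v , v∈ , v⊑y

  predecessorBasis-complete : ∀ N B {x y} → Step N x y → y ∈↑ B → x ∈↑ predecessorBasis N B
  predecessorBasis-complete N B (a , A , b , τ∈ , a⊑x , y≡) (v , v∈ , v⊑y) =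
    let (u , u∈ , u⊑x) =
          minimalPredecessors-complete {v} {a} {A} {b} a⊑x (λ i → ≤-trans (v⊑y i) (≤-reflexive (y≡ i)))
    in u , ∈-concatMap⁺ (uncurry minimalPredecessors) (lose (∈-cartesianProduct⁺ v∈ τ∈) u∈) , u⊑x

δ-diagonal : ∀ {d} (i : Fin d) → δ i i ≡ 1
δ-diagonal zero = refl
δ-diagonal (suc i) = δ-diagonal i

module _ {d : ℕ} where

  sourceBound : AffineNet d → ℕ
  sourceBound [] = 0
  sourceBound ((a , _ , _) ∷ N) = Σ[< d ] a + sourceBound N

  source-≤-sourceBound : ∀ {N a A b} → (a , A , b) ∈ N → ∀ i → a i ≤ sourceBound N
  source-≤-sourceBound {a = a} (here refl) i = ≤-trans (Σ-≤ a i) (m≤m+n _ _)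
  source-≤-sourceBound {N = _ ∷ N} (there τ∈) i = ≤-trans (source-≤-sourceBound τ∈ i) (m≤n+m _ _)

  Step-≤+sourceBound : ∀ {N x y} → StrictlyIncreasing N → Step N x y → ∀ i → x i ≤ y i + sourceBound N
  Step-≤+sourceBound {N} {x} {y} SI (a , A , b , τ∈ , a⊑x , y≡) i = begin
    x i                             ≡⟨ sym (m∸n+n≡m (a⊑x i)) ⟩
    (x -v a) i + a i                ≤⟨ +-mono-≤ (≤-trans (·-inflationary A (x -v a) i 1≤Aii) (m≤m+n _ (b i)))
                                                (source-≤-sourceBound τ∈ i) ⟩
    (A · (x -v a)) i + b i + sourceBound N ≡⟨ cong (_+ sourceBound N) (sym (y≡ i)) ⟩
    y i + sourceBound N             ∎
    where
    open ≤-Reasoning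
    1≤Aii : 1 ≤ A i i
    1≤Aii = subst (_≤ A i i) (δ-diagonal i) (SI τ∈ i i)

  -- On the ω-coordinates of I, fillω I n equals n, and a step lowers a coordinate by at most
  -- sourceBound N, so y exceeds every finite entry of L there.
  fillω-Step-ωsub : ∀ {N I n y L J} → StrictlyIncreasing N → Step N (fillω I n) y → J ∈ L → y ⊑I J →
                    bound L + sourceBound N < n → ωsub I J
  fillω-Step-ωsub {N} {I} {n} {y} {L} SI x→y J∈ y⊑J lt i Ii≡ω =
    beyond-bound⇒ω J∈ (+-cancelʳ-≤ (sourceBound N) _ (y i) (≤-trans lt n≤yi+S)) i (y⊑J i)
    where
    n≤yi+S : n ≤ y i + sourceBound N
    n≤yi+S = subst (_≤ y i + sourceBound N) (fillω-ω I n Ii≡ω) (Step-≤+sourceBound SI x→y i)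

module Chain {d : ℕ} (N : AffineNet d) (t : Vecℕ d) where

  basis : ℕ → List (Vecℕ d)
  basis zero = [ t ]
  basis (suc k) = basis k ++ predecessorBasis N (basis k)

  Dchain⇒∉↑basis : ∀ k {x} → Dchain N t k x → ¬ x ∈↑ basis k
  Dchain⇒∉↑basis zero t⋢x (_ , here refl , t⊑x) = t⋢x t⊑x
  Dchain⇒∉↑basis (suc k) (x∈D , x∈Pre) (u , u∈ , u⊑x) with ∈-++⁻ (basis k) u∈
  ... | inj₁ u∈basis = Dchain⇒∉↑basis k x∈D (u , u∈basis , u⊑x)
  ... | inj₂ u∈pre =
    let (y , x→y , y∈↑) = predecessorBasis-sound N (basis k) (u , u∈pre , u⊑x)
    in Dchain⇒∉↑basis k (x∈Pre y x→y) y∈↑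

  ∉↑basis⇒Dchain : ∀ k {x} → ¬ x ∈↑ basis k → Dchain N t k x
  ∉↑basis⇒Dchain zero x∉↑ t⊑x = x∉↑ (_ , here refl , t⊑x)
  ∉↑basis⇒Dchain (suc k) x∉↑ =
      ∉↑basis⇒Dchain k (λ (u , u∈ , u⊑x) → x∉↑ (u , ∈-++⁺ˡ u∈ , u⊑x))
    , λ y x→y → ∉↑basis⇒Dchain k λ y∈↑ →
        let (u , u∈ , u⊑x) = predecessorBasis-complete N (basis k) x→y y∈↑
        in x∉↑ (u , ∈-++⁺ʳ (basis k) u∈ , u⊑x)

  Dchain-canonical : ∀ k → ∃ λ L → IsCanonicalDecomp (Dchain N t k) L
  Dchain-canonical k = _ , upsetComplement-canonical (basis k)
    (λ x → mk⇔ (Dchain⇒∉↑basis k) (∉↑basis⇒Dchain k))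

  Dchain-exit : ∀ k {x} → Dchain N t (suc k) x → ¬ Dchain N t (suc (suc k)) x →
                ∃ λ y → Step N x y × ¬ Dchain N t (suc k) y
  Dchain-exit k {x} x∈D₁ x∉D₂ with x ∈↑? basis (suc (suc k))
  ... | no x∉↑ = ⊥-elim (x∉D₂ (∉↑basis⇒Dchain (suc (suc k)) x∉↑))
  ... | yes (u , u∈ , u⊑x) with ∈-++⁻ (basis (suc k)) u∈
  ...   | inj₁ u∈basis = ⊥-elim (Dchain⇒∉↑basis (suc k) x∈D₁ (u , u∈basis , u⊑x))
  ...   | inj₂ u∈pre =
    let (y , x→y , y∈↑) = predecessorBasis-sound N (basis (suc k)) (u , u∈pre , u⊑x)
    in y , x→y , λ y∈D₁ → Dchain⇒∉↑basis (suc k) y∈D₁ y∈↑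

claim4p17 : (d : ℕ) (N : AffineNet d) → StrictlyIncreasing N → (t : Vecℕ d) → OmegaMonotone N t
claim4p17 d N SI t k I ((L₁ , dec₁ , I∈L₁) , I∉dec₂) =
  let open Chain N t
      (L₀ , dec₀) = Dchain-canonical k
      (L₂ , dec₂) = Dchain-canonical (suc (suc k))
      n = suc (bound L₀ + sourceBound N + bound L₂)
      x∈D₁ = ∈dec-⊆ (L₁ , dec₁ , I∈L₁) (fillω-⊑I I n)
      x∉D₂ = fillω-escapes dec₁ I∈L₁ I∉dec₂ dec₂ proj₁ (s≤s (m≤n+m _ _))
      (y , x→y , y∉D₁) = Dchain-exit k x∈D₁ x∉D₂
      (J , J∈L₀ , y⊑J) = Equivalence.to (proj₁ dec₀ y) (proj₂ x∈D₁ y x→y)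
  in J , ((L₀ , dec₀ , J∈L₀) , λ J∈dec₁ → y∉D₁ (∈dec-⊆ J∈dec₁ y⊑J))
       , fillω-Step-ωsub SI x→y J∈L₀ y⊑J (s≤s (m≤m+n _ _))
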